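{- Let $(K_n,\Sigma)$ be a signed complete graph with $n\geq4$, and let $X(\Sigma)$ be the set of edges $vw$ of $K_n$ such that the triangle $uvw$ is even for every $u\in V(K_n)\setminus\{v,w\}$. Then there exist a signed complete graph $(K_k,\Sigma')$ with vertex set $\{v_1,\dots,v_k\}$ and complete graphs $H_1,\dots,H_k$ whose vertex sets partition $V(K_n)$ with $X(\Sigma)=\bigcup_{i=1}^kE(H_i)$, such that $(K_n,\Sigma)$ is switching equivalent to the signed graph obtained from $(K_k,\Sigma')$ by substituting $v_i$ with $(H_i,\emptyset)$ for each $i\in[k]$.
   Context: A signed graph is a pair $(G,\Sigma)$ with $\Sigma\subseteq E(G)$; edges in $\Sigma$ are odd, others even. A triangle is odd (resp. even) if it contains an odd (resp. even) number of edges of $\Sigma$. Switching at a vertex $v$ replaces $\Sigma$ by $\Sigma\triangle\delta(v)$, $\delta(v)$ the set of edges at $v$; two signed graphs are switching equivalent if one is obtained from the other by a sequence of switchings. Substituting a vertex $v$ of $(G,\Sigma)$ with $(H,\Gamma)$ (disjoint vertex sets) means: take the disjoint union of $(G-v,\Sigma\setminus\delta(v))$ and $(H,\Gamma)$, and add all edges $uv'$ with $u\in V(H)$, $v'\in N_G(v)$, where $uv'$ is odd iff $vv'$ is odd in $(G,\Sigma)$. -}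

module Defs where

open import Data.Nat using (ℕ)
open import Data.Bool using (Bool; true; false; _xor_; if_then_else_)
open import Data.Fin using (Fin; _≟_)
open import Data.Product using (Σ; _×_; ∃)
open import Relation.Nullary using (¬_; does)
open import Relation.Binary.PropositionalEquality using (_≡_; _≢_)
open import Function.Bundles using (_⇔_)

-- A signed complete graph (K_n, Σ) on vertex set Fin n: Σ is given by its
-- indicator σ u w (true = the edge uw is odd, i.e. in Σ). Only values on
-- pairs u ≢ w matter; σ must be symmetric.
Signature : ℕ → Set
Signature n = Fin n → Fin n → Bool

Symmetric : ∀ {n} → Signature n → Set
Symmetric σ = ∀ u w → σ u w ≡ σ w u

SameEdges : ∀ {n} → Signature n → Signature n → Set
SameEdges σ τ = ∀ u w → u ≢ w → σ u w ≡ τ u w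

incident : ∀ {n} → Fin n → Fin n → Fin n → Bool
incident v u w = does (u ≟ v) xor does (w ≟ v)

SwitchAt : ∀ {n} → Fin n → Signature n → Signature n → Set
SwitchAt v σ τ = ∀ u w → u ≢ w → τ u w ≡ (σ u w xor incident v u w)

data SwitchEquiv {n : ℕ} : Signature n → Signature n → Set where
  sw-refl : ∀ {σ τ} → SameEdges σ τ → SwitchEquiv σ τ
  sw-step : ∀ {σ τ ρ} (v : Fin n) → SwitchEquiv σ τ → SwitchAt v τ ρ → SwitchEquiv σ ρ

EvenTriangle : ∀ {n} → Signature n → Fin n → Fin n → Fin n → Set
EvenTriangle σ u v w = (σ u v xor σ v w xor σ u w) ≡ false

InX : ∀ {n} → Signature n → Fin n → Fin n → Set
InX σ v w = ∀ u → u ≢ v → u ≢ w → EvenTriangle σ u v w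

-- A partition of V(K_n) into k nonempty blocks H_1..H_k, encoded by the
-- block map f (H_i = f⁻¹(i)); surjectivity = blocks nonempty.
Surjective : ∀ {n k} → (Fin n → Fin k) → Set
Surjective {k = k} f = ∀ (i : Fin k) → ∃ λ u → f u ≡ i

-- The signed graph obtained from (K_k, σ') by substituting each v_i with
-- (H_i, ∅), where H_i is the complete graph on f⁻¹(i). Its vertex set is
-- ⋃ V(H_i) = Fin n; edges inside a block are even, an edge between blocks
-- i ≠ j has the sign of v_i v_j in σ'.
substitute : ∀ {n k} → Signature k → (Fin n → Fin k) → Signature n
substitute σ' f u w = if does (f u ≟ f w) then false else σ' (f u) (f w)

-- Switch at the odd neighbours of a vertex z, so that every edge at z becomes even; switching
-- does not change the parity of any triangle, hence not X(Σ) either. In the switched graph an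
-- edge vw of X is even (look at the triangle zvw), so for every other vertex u the triangle uvw
-- is even exactly when uv and uw have the same sign: v and w are twins. The reflexive closure of
-- X is an equivalence relation (the four triangles of a tetrahedron have even total parity), its
-- classes are the cliques H_i, all edges inside a class are even and the sign of an edge between
-- two classes only depends on the classes, which defines Σ'.
module Submission where

open import Defs
open import Data.Nat using (ℕ; _≤_; zero; suc)
open import Data.Fin using (Fin; zero; suc; _≟_)
open import Data.Fin.Properties using (any?; all?; suc-injective)
open import Data.Bool using (Bool; true; false; _xor_; if_then_else_)
open import Data.Bool.Properties using (xor-same; xor-comm; xor-identityʳ) renaming (_≟_ to _≟ᵇ_)
open import Data.Bool.Solver using (module xor-∧-Solver)
open import Data.List using (List; []; _∷_; map)
open import Data.Product using (Σ; _×_; ∃; _,_; proj₁; proj₂)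
open import Data.Empty using (⊥-elim)
open import Function.Base using (_∘_)
open import Function.Bundles using (_⇔_; mk⇔; Equivalence)
open import Function.Properties.Equivalence using () renaming (trans to ⇔-trans)
open import Relation.Nullary using (Dec; yes; no; does)
open import Relation.Nullary.Decidable using (¬?; _→-dec_)
open import Relation.Binary.Core using (Rel)
open import Relation.Binary.Definitions using (Transitive; Decidable)
open import Relation.Binary.Structures using (IsDecEquivalence)
open import Relation.Binary.PropositionalEquality
open import Relation.Binary.Construct.Closure.Reflexive using (ReflClosure; refl; [_])
import Relation.Binary.Construct.Closure.Reflexive.Properties as ReflClosure
import Relation.Binary.Construct.On as On

open xor-∧-Solver using (solve; _:+_; _:=_)
open Equivalence using (to; from)

xor≡false⇒≡ : ∀ a b → a xor b ≡ false → a ≡ b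
xor≡false⇒≡ false false _ = refl
xor≡false⇒≡ true  true  _ = refl

parity : ∀ {n} → Signature n → Fin n → Fin n → Fin n → Bool
parity σ u v w = σ u v xor σ v w xor σ u w

parity-tetrahedron : ∀ {n} (σ : Signature n) u v w x →
  parity σ u v w xor parity σ u w x xor parity σ v w x ≡ parity σ u v x
parity-tetrahedron σ u v w x =
  solve 6 (λ uv vw uw wx ux vx →
             (uv :+ (vw :+ uw)) :+ ((uw :+ (wx :+ ux)) :+ (vw :+ (wx :+ vx))) := uv :+ (vx :+ ux))
          refl (σ u v) (σ v w) (σ u w) (σ w x) (σ u x) (σ v x)

module _ {n} {σ : Signature n} (σ-sym : Symmetric σ) where

  parity-swap₁₂ : ∀ u v w → parity σ u v w ≡ parity σ v u w
  parity-swap₁₂ u v w rewrite σ-sym v u =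
    solve 3 (λ a b c → a :+ (b :+ c) := a :+ (c :+ b)) refl (σ u v) (σ v w) (σ u w)

  parity-swap₂₃ : ∀ u v w → parity σ u v w ≡ parity σ u w v
  parity-swap₂₃ u v w rewrite σ-sym w v =
    solve 3 (λ a b c → a :+ (b :+ c) := c :+ (b :+ a)) refl (σ u v) (σ v w) (σ u w)

  InX-sym : ∀ {v w} → InX σ v w → InX σ w v
  InX-sym {v} {w} X u u≢w u≢v = trans (parity-swap₂₃ u w v) (X u u≢v u≢w)

  InX-trans : ∀ {v w x} → v ≢ w → v ≢ x → InX σ v w → InX σ w x → InX σ v x
  InX-trans {v} {w} {x} v≢w v≢x X₁ X₂ u u≢v u≢x with u ≟ w
  ... | yes refl = trans (parity-swap₁₂ w v x) (X₂ v v≢w v≢x)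
  ... | no u≢w = begin
    parity σ u v x                                       ≡⟨ parity-tetrahedron σ u v w x ⟨
    parity σ u v w xor parity σ u w x xor parity σ v w x ≡⟨ cong₂ _xor_ (X₁ u u≢v u≢w) (cong₂ _xor_ (X₂ u u≢w u≢x) (X₂ v v≢w v≢x)) ⟩
    false                                                ∎
    where open ≡-Reasoning

  ReflClosure-InX-trans : Transitive (ReflClosure (InX σ))
  ReflClosure-InX-trans refl   r      = r
  ReflClosure-InX-trans [ X₁ ] refl   = [ X₁ ]
  ReflClosure-InX-trans {v} {w} {x} [ X₁ ] [ X₂ ] with v ≟ w | v ≟ x
  ... | yes refl | _        = [ X₂ ]
  ... | no _     | yes refl = refl
  ... | no v≢w   | no v≢x   = [ InX-trans v≢w v≢x X₁ X₂ ]

InX? : ∀ {n} (σ : Signature n) → Decidable (InX σ)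
InX? σ v w = all? λ u → ¬? (u ≟ v) →-dec ¬? (u ≟ w) →-dec parity σ u v w ≟ᵇ false

ReflClosure-InX-isDecEquivalence : ∀ {n} {σ : Signature n} → Symmetric σ →
  IsDecEquivalence (ReflClosure (InX σ))
ReflClosure-InX-isDecEquivalence {σ = σ} σ-sym = record
  { isEquivalence = record
    { refl  = refl
    ; sym   = ReflClosure.sym (InX-sym σ-sym)
    ; trans = ReflClosure-InX-trans σ-sym
    }
  ; _≟_ = ReflClosure.dec _≟_ (InX? σ)
  }

⇔ReflClosure : ∀ {a ℓ} {A : Set a} {_∼_ : Rel A ℓ} {x y} → x ≢ y → x ∼ y ⇔ ReflClosure _∼_ x y
⇔ReflClosure x≢y = mk⇔ [_] λ { refl → ⊥-elim (x≢y refl) ; [ x∼y ] → x∼y }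

switchBy : ∀ {n} → (Fin n → Bool) → Signature n → Signature n
switchBy s σ u w = σ u w xor s u xor s w

switchBy-sym : ∀ {n} (s : Fin n → Bool) {σ : Signature n} → Symmetric σ → Symmetric (switchBy s σ)
switchBy-sym s σ-sym u w = cong₂ _xor_ (σ-sym u w) (xor-comm (s u) (s w))

parity-switchBy : ∀ {n} (s : Fin n → Bool) (σ : Signature n) u v w →
  parity (switchBy s σ) u v w ≡ parity σ u v w
parity-switchBy s σ u v w =
  solve 6 (λ uv vw uw su sv sw →
             (uv :+ (su :+ sv)) :+ ((vw :+ (sv :+ sw)) :+ (uw :+ (su :+ sw))) := uv :+ (vw :+ uw))
          refl (σ u v) (σ v w) (σ u w) (s u) (s v) (s w)

InX⇔InX-switchBy : ∀ {n} (s : Fin n → Bool) (σ : Signature n) {v w} → InX σ v w ⇔ InX (switchBy s σ) v w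
InX⇔InX-switchBy s σ {v} {w} = mk⇔
  (λ X u u≢v u≢w → trans (parity-switchBy s σ u v w) (X u u≢v u≢w))
  (λ X u u≢v u≢w → trans (sym (parity-switchBy s σ u v w)) (X u u≢v u≢w))

SwitchEquiv-respʳ : ∀ {n} {σ τ τ′ : Signature n} → SwitchEquiv σ τ → SameEdges τ τ′ → SwitchEquiv σ τ′
SwitchEquiv-respʳ (sw-refl σ≈τ)   τ≈τ′ = sw-refl λ u w u≢w → trans (σ≈τ u w u≢w) (τ≈τ′ u w u≢w)
SwitchEquiv-respʳ (sw-step v σ∼ρ ρ→τ) τ≈τ′ = sw-step v σ∼ρ λ u w u≢w → trans (sym (τ≈τ′ u w u≢w)) (ρ→τ u w u≢w)

-- Switching at every vertex of vs in turn switches each vertex as often as it occurs in vs.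
occursOddly : ∀ {n} → List (Fin n) → Fin n → Bool
occursOddly []       x = false
occursOddly (v ∷ vs) x = does (x ≟ v) xor occursOddly vs x

switchEquiv-switchBy-occursOddly : ∀ {n} (σ : Signature n) vs → SwitchEquiv σ (switchBy (occursOddly vs) σ)
switchEquiv-switchBy-occursOddly σ []       = sw-refl λ u w _ → sym (xor-identityʳ (σ u w))
switchEquiv-switchBy-occursOddly σ (v ∷ vs) = sw-step v (switchEquiv-switchBy-occursOddly σ vs) λ u w _ →
  solve 5 (λ uw eu ou ew ow → uw :+ ((eu :+ ou) :+ (ew :+ ow)) := (uw :+ (ou :+ ow)) :+ (eu :+ ew))
        refl (σ u w) (does (u ≟ v)) (occursOddly vs u) (does (w ≟ v)) (occursOddly vs w)

occursOddly-map-suc-zero : ∀ {n} (vs : List (Fin n)) → occursOddly (map suc vs) zero ≡ false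
occursOddly-map-suc-zero []       = refl
occursOddly-map-suc-zero (v ∷ vs) = occursOddly-map-suc-zero vs

occursOddly-map-suc : ∀ {n} (vs : List (Fin n)) x → occursOddly (map suc vs) (suc x) ≡ occursOddly vs x
occursOddly-map-suc []       x = refl
occursOddly-map-suc (v ∷ vs) x = cong (does (x ≟ v) xor_) (occursOddly-map-suc vs x)

occursOddly-surjective : ∀ {n} (s : Fin n → Bool) → ∃ λ vs → ∀ x → occursOddly vs x ≡ s x
occursOddly-surjective {zero}  s = [] , λ ()
occursOddly-surjective {suc n} s with occursOddly-surjective (s ∘ suc) | s zero in s₀
... | vs , vs-s | true  = zero ∷ map suc vs , λ
  { zero    → trans (cong (true xor_) (occursOddly-map-suc-zero vs)) (sym s₀)
  ; (suc x) → trans (occursOddly-map-suc vs x) (vs-s x) }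
... | vs , vs-s | false = map suc vs , λ
  { zero    → trans (occursOddly-map-suc-zero vs) (sym s₀)
  ; (suc x) → trans (occursOddly-map-suc vs x) (vs-s x) }

switchEquiv-switchBy : ∀ {n} (s : Fin n → Bool) (σ : Signature n) → SwitchEquiv σ (switchBy s σ)
switchEquiv-switchBy s σ with occursOddly-surjective s
... | vs , vs-s = SwitchEquiv-respʳ (switchEquiv-switchBy-occursOddly σ vs) λ u w _ →
  cong₂ (λ a b → σ u w xor a xor b) (vs-s u) (vs-s w)

oddNeighboursOfZero : ∀ {m} → Signature (suc m) → Fin (suc m) → Bool
oddNeighboursOfZero σ zero    = false
oddNeighboursOfZero σ (suc x) = σ zero (suc x)

switchBy-oddNeighboursOfZero : ∀ {m} (σ : Signature (suc m)) y →
  switchBy (oddNeighboursOfZero σ) σ zero (suc y) ≡ false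
switchBy-oddNeighboursOfZero σ y = xor-same (σ zero (suc y))

record Quotient {n ℓ} (_≈_ : Rel (Fin n) ℓ) : Set ℓ where
  field
    size               : ℕ
    classOf            : Fin n → Fin size
    classOf-surjective : Surjective classOf
    ≈⇔classOf≡         : ∀ v w → v ≈ w ⇔ classOf v ≡ classOf w

  representative : Fin size → Fin n
  representative i = proj₁ (classOf-surjective i)

  classOf-representative : ∀ i → classOf (representative i) ≡ i
  classOf-representative i = proj₂ (classOf-surjective i)

quotient : ∀ {n ℓ} {_≈_ : Rel (Fin n) ℓ} → IsDecEquivalence _≈_ → Quotient _≈_
quotient {zero} _ = record { size = 0 ; classOf = λ () ; classOf-surjective = λ () ; ≈⇔classOf≡ = λ () }
quotient {suc n} {_≈_ = _≈_} ≈-isDecEquivalence = extend (any? λ w → zero E.≟ suc w)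
  where
  module E = IsDecEquivalence ≈-isDecEquivalence
  module Q = Quotient (quotient (On.isDecEquivalence suc ≈-isDecEquivalence))

  extend : Dec (∃ λ w → zero ≈ suc w) → Quotient _≈_
  extend (yes (w , 0≈w)) = record
    { size = Q.size ; classOf = c ; classOf-surjective = c-surjective ; ≈⇔classOf≡ = ≈⇔c≡ }
    where
    c : Fin (suc n) → Fin Q.size
    c zero    = Q.classOf w
    c (suc v) = Q.classOf v

    c-surjective : Surjective c
    c-surjective i = suc (Q.representative i) , Q.classOf-representative i

    zero≈⇔ : ∀ v → zero ≈ suc v ⇔ Q.classOf w ≡ Q.classOf v
    zero≈⇔ v = mk⇔ (λ 0≈v → to (Q.≈⇔classOf≡ w v) (E.trans (E.sym 0≈w) 0≈v))
                   (λ w~v → E.trans 0≈w (from (Q.≈⇔classOf≡ w v) w~v))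

    ≈⇔c≡ : ∀ v v′ → v ≈ v′ ⇔ c v ≡ c v′
    ≈⇔c≡ zero    zero     = mk⇔ (λ _ → refl) (λ _ → E.refl)
    ≈⇔c≡ zero    (suc v)  = zero≈⇔ v
    ≈⇔c≡ (suc v) zero     = mk⇔ (λ v≈0 → sym (to (zero≈⇔ v) (E.sym v≈0)))
                                (λ v~w → E.sym (from (zero≈⇔ v) (sym v~w)))
    ≈⇔c≡ (suc v) (suc v′) = Q.≈⇔classOf≡ v v′
  extend (no 0≉suc) = record
    { size = suc Q.size ; classOf = c ; classOf-surjective = c-surjective ; ≈⇔classOf≡ = ≈⇔c≡ }
    where
    c : Fin (suc n) → Fin (suc Q.size)
    c zero    = zero
    c (suc v) = suc (Q.classOf v)

    c-surjective : Surjective c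
    c-surjective zero    = zero , refl
    c-surjective (suc i) = suc (Q.representative i) , cong suc (Q.classOf-representative i)

    ≈⇔c≡ : ∀ v v′ → v ≈ v′ ⇔ c v ≡ c v′
    ≈⇔c≡ zero    zero     = mk⇔ (λ _ → refl) (λ _ → E.refl)
    ≈⇔c≡ zero    (suc v)  = mk⇔ (λ 0≈v → ⊥-elim (0≉suc (v , 0≈v))) λ ()
    ≈⇔c≡ (suc v) zero     = mk⇔ (λ v≈0 → ⊥-elim (0≉suc (v , E.sym v≈0))) λ ()
    ≈⇔c≡ (suc v) (suc v′) = mk⇔ (cong suc ∘ to (Q.≈⇔classOf≡ v v′)) (from (Q.≈⇔classOf≡ v v′) ∘ suc-injective)

sameEdges-substitute : ∀ {n k} {τ : Signature n} → Symmetric τ →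
  (f : Fin n → Fin k) (rep : Fin k → Fin n) → (∀ i → f (rep i) ≡ i) →
  (∀ u w → u ≢ w → f u ≡ f w → τ u w ≡ false) →
  (∀ u u′ w → f u ≡ f u′ → f u ≢ f w → τ u w ≡ τ u′ w) →
  SameEdges τ (substitute (λ i j → τ (rep i) (rep j)) f)
sameEdges-substitute {τ = τ} τ-sym f rep f-rep even-inside constant-across u w u≢w = byClasses (f u ≟ f w)
  where
  open ≡-Reasoning
  byClasses : (d : Dec (f u ≡ f w)) → τ u w ≡ (if does d then false else τ (rep (f u)) (rep (f w)))
  byClasses (yes fu≡fw) = even-inside u w u≢w fu≡fw
  byClasses (no fu≢fw)  = begin
    τ u w                     ≡⟨ constant-across u (rep (f u)) w (sym (f-rep (f u))) fu≢fw ⟩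
    τ (rep (f u)) w           ≡⟨ τ-sym _ _ ⟩
    τ w (rep (f u))           ≡⟨ constant-across w (rep (f w)) (rep (f u)) (sym (f-rep (f w)))
                                   (λ fw≡ → fu≢fw (sym (trans fw≡ (f-rep (f u))))) ⟩
    τ (rep (f w)) (rep (f u)) ≡⟨ τ-sym _ _ ⟩
    τ (rep (f u)) (rep (f w)) ∎

module _ {m} {τ : Signature (suc m)} (τ-sym : Symmetric τ) (τ-evenAtZero : ∀ y → τ zero (suc y) ≡ false) where

  InX⇒even : ∀ {v w} → v ≢ w → InX τ v w → τ v w ≡ false
  InX⇒even {zero}  {zero}  v≢w _ = ⊥-elim (v≢w refl)
  InX⇒even {zero}  {suc y} _   _ = τ-evenAtZero y
  InX⇒even {suc x} {zero}  _   _ = trans (τ-sym _ _) (τ-evenAtZero x)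
  InX⇒even {suc x} {suc y} _   X = begin
    τ (suc x) (suc y)           ≡⟨ xor-identityʳ _ ⟨
    τ (suc x) (suc y) xor false ≡⟨ cong₂ (λ a b → a xor τ (suc x) (suc y) xor b) (τ-evenAtZero x) (τ-evenAtZero y) ⟨
    parity τ zero (suc x) (suc y) ≡⟨ X zero (λ ()) (λ ()) ⟩
    false                       ∎
    where open ≡-Reasoning

  InX⇒sameSign : ∀ {u v w} → v ≢ w → u ≢ v → u ≢ w → InX τ v w → τ u v ≡ τ u w
  InX⇒sameSign {u} {v} {w} v≢w u≢v u≢w X = xor≡false⇒≡ (τ u v) (τ u w)
    (subst (λ b → τ u v xor b xor τ u w ≡ false) (InX⇒even v≢w X) (X u u≢v u≢w))

  module _ {k} (f : Fin (suc m) → Fin k) (InX⇔f≡ : ∀ v w → v ≢ w → InX τ v w ⇔ f v ≡ f w) where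

    even-inside-classes : ∀ u w → u ≢ w → f u ≡ f w → τ u w ≡ false
    even-inside-classes u w u≢w fu≡fw = InX⇒even u≢w (from (InX⇔f≡ u w u≢w) fu≡fw)

    constant-across-classes : ∀ u u′ w → f u ≡ f u′ → f u ≢ f w → τ u w ≡ τ u′ w
    constant-across-classes u u′ w fu≡fu′ fu≢fw with u ≟ u′
    ... | yes refl = refl
    ... | no u≢u′  = begin
      τ u w  ≡⟨ τ-sym u w ⟩
      τ w u  ≡⟨ InX⇒sameSign u≢u′ (λ { refl → fu≢fw refl }) (λ { refl → fu≢fw fu≡fu′ })
                  (from (InX⇔f≡ u u′ u≢u′) fu≡fu′) ⟩
      τ w u′ ≡⟨ τ-sym w u′ ⟩
      τ u′ w ∎
      where open ≡-Reasoning

-- The hypothesis n ≥ 4 is only needed to have a vertex at which to normalise.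
lemma3p7 : (n : ℕ) → 4 ≤ n → (σ : Signature n) → Symmetric σ →
    Σ ℕ λ k → Σ (Signature k) λ σ' → Σ (Fin n → Fin k) λ f →
      Symmetric σ' × Surjective f ×
      (∀ v w → v ≢ w → (InX σ v w ⇔ f v ≡ f w)) ×
      SwitchEquiv σ (substitute σ' f)
lemma3p7 zero ()
lemma3p7 (suc m) _ σ σ-sym =
  size , σ′ , classOf , (λ i j → τ-sym _ _) , classOf-surjective , InX⇔sameClass , σ∼substitute
  where
  s : Fin (suc m) → Bool
  s = oddNeighboursOfZero σ
  τ : Signature (suc m)
  τ = switchBy s σ
  τ-sym : Symmetric τ
  τ-sym = switchBy-sym s σ-sym
  open Quotient (quotient (ReflClosure-InX-isDecEquivalence τ-sym))
  σ′ : Signature size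
  σ′ i j = τ (representative i) (representative j)
  InX[τ]⇔sameClass : ∀ v w → v ≢ w → InX τ v w ⇔ classOf v ≡ classOf w
  InX[τ]⇔sameClass v w v≢w = ⇔-trans (⇔ReflClosure v≢w) (≈⇔classOf≡ v w)
  InX⇔sameClass : ∀ v w → v ≢ w → InX σ v w ⇔ classOf v ≡ classOf w
  InX⇔sameClass v w v≢w = ⇔-trans (InX⇔InX-switchBy s σ) (InX[τ]⇔sameClass v w v≢w)
  σ∼substitute : SwitchEquiv σ (substitute σ′ classOf)
  σ∼substitute = SwitchEquiv-respʳ (switchEquiv-switchBy s σ)
    (sameEdges-substitute τ-sym classOf representative classOf-representative
      (even-inside-classes τ-sym (switchBy-oddNeighboursOfZero σ) classOf InX[τ]⇔sameClass)
      (constant-across-classes τ-sym (switchBy-oddNeighboursOfZero σ) classOf InX[τ]⇔sameClass))
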